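{- Let $d\ge 1$ and $\ell_1,\dots,\ell_d\ge 1$ be integers, let $\mathscr{M}=\{(x_1,\dots,x_d)\in\mathbb{Z}^d : 0\le x_i\le \ell_i-1 \text{ for all } i\}$ with the componentwise partial order, and let $\mathrm{wt}:\mathscr{M}\to\mathbb{R}$ be a rank increasing and rank constant weight function. Suppose that: (1) $A\subseteq\mathscr{M}$ is a downset; (2) $\mathscr{Q}=\prod_{i=1}^d\{x\in\mathbb{Z}: a_i\le x\le b_i\}\subseteq \mathscr{M}$ is a packed poset, with $0\le a_i\le b_i\le \ell_i-1$; (3) $O\subseteq A\cap\mathscr{Q}$ is such that $A\setminus O$ is a downset; (4) $c_1,c_2\in[d]$ are coordinates with $b_{c_1}-a_{c_1}=b_{c_2}-a_{c_2}$, and $R=\{\rho(f): f\in O\}$, where $\rho$ denotes the reflection within $\mathscr{Q}$ about $\{c_1,c_2\}$; (5) $P\subseteq \mathscr{M}\setminus A$ is such that $(A\setminus O)\cup P$ is a downset; (6) $\sigma:R\to P$ is a bijection with $\mathrm{wt}(f)\le \mathrm{wt}(\sigma(f))$ for all $f\in R$. Then $\mathrm{wt}(A)\le \mathrm{wt}((A\setminus O)\cup P)$. Moreover, if there is $f\in R$ with $\mathrm{wt}(f)<\mathrm{wt}(\sigma(f))$, then $\mathrm{wt}(A)<\mathrm{wt}((A\setminus O)\cup P)$, and hence $A$ is not an optimal downset.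
   Context: A downset of a poset is a subset $A$ such that $a\le b$ and $b\in A$ imply $a\in A$. The rank of $x=(x_1,\dots,x_d)\in\mathscr{M}$ is $x_1+\dots+x_d$. A weight function $\mathrm{wt}:\mathscr{M}\to\mathbb{R}$ is rank constant if elements of equal rank have equal weight, and rank increasing if an element of strictly smaller rank has strictly smaller weight. For finite $S$, $\mathrm{wt}(S)=\sum_{s\in S}\mathrm{wt}(s)$. A downset $A$ is optimal if $\mathrm{wt}(A)\ge \mathrm{wt}(S)$ for every downset $S\subseteq\mathscr{M}$ with $|S|=|A|$. A packed poset is a subset of $\mathscr{M}$ that is a product of integer intervals $\prod_i [a_i,b_i]$. The reflection within $\mathscr{Q}=\prod_i[a_i,b_i]$ about $\{c_1,c_2\}$ (when $b_{c_1}-a_{c_1}=b_{c_2}-a_{c_2}$) sends $f\in\mathscr{Q}$ to $g\in\mathscr{Q}$ with $g_{c_1}=a_{c_1}+(f_{c_2}-a_{c_2})$, $g_{c_2}=a_{c_2}+(f_{c_1}-a_{c_1})$, and $g_c=f_c$ for all other $c$ (it is the identity if $c_1=c_2$). -}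

module Defs where

open import Level using (Level; _⊔_) renaming (suc to lsuc)
open import Data.Nat using (ℕ; zero; suc; _+_; _∸_; _≤_; _<_)
open import Data.Fin using (Fin)
open import Data.Bool using (Bool; true; false; T; not; _∧_; _∨_; if_then_else_)
open import Data.Vec using (Vec; []; _∷_; lookup; _[_]≔_)
import Data.Vec as V
open import Data.List using (List; []; _∷_; map; concatMap; upTo; foldr; length; filter)
open import Data.Bool using (T?)
open import Data.Product using (Σ; ∃; _×_)
open import Relation.Binary using (Rel; IsTotalOrder)
open import Relation.Binary.PropositionalEquality using (_≡_; _≢_)
open import Relation.Nullary using (¬_)
open import Algebra.Structures using (IsAbelianGroup)

-- The paper uses ℝ; the statement only
-- involves the additive ordered-group structure of ℝ, so we quantify
-- over an arbitrary totally ordered abelian group (ℝ is an instance).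

record OrdAbGroup (c ℓ : Level) : Set (lsuc (c ⊔ ℓ)) where
  infixl 6 _+ᴳ_
  infix 4 _≤ᴳ_ _<ᴳ_
  field
    Carrier        : Set c
    _+ᴳ_           : Carrier → Carrier → Carrier
    0ᴳ             : Carrier
    -ᴳ_            : Carrier → Carrier
    _≤ᴳ_           : Rel Carrier ℓ
    isAbelianGroup : IsAbelianGroup _≡_ _+ᴳ_ 0ᴳ -ᴳ_
    isTotalOrder   : IsTotalOrder _≡_ _≤ᴳ_
    +-mono-≤       : ∀ {x y} z → x ≤ᴳ y → (x +ᴳ z) ≤ᴳ (y +ᴳ z)

  _<ᴳ_ : Carrier → Carrier → Set (c ⊔ ℓ)
  x <ᴳ y = (x ≤ᴳ y) × (x ≢ y)

-- Points of ℤ^d (all relevant points have nonnegative coordinates).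

Point : ℕ → Set
Point d = Vec ℕ d

_≤ᵖ_ : ∀ {d} → Point d → Point d → Set
_≤ᵖ_ {d} x y = ∀ (i : Fin d) → lookup x i ≤ lookup y i

rank : ∀ {d} → Point d → ℕ
rank = V.sum

InM : ∀ {d} → Vec ℕ d → Point d → Set
InM {d} ℓ x = ∀ (i : Fin d) → lookup x i < lookup ℓ i

box : ∀ {d} → Vec ℕ d → List (Point d)
box []       = [] ∷ []
box (l ∷ ls) = concatMap (λ i → map (i ∷_) (box ls)) (upTo l)

InQ : ∀ {d} → Vec ℕ d → Vec ℕ d → Point d → Set
InQ {d} a b x = ∀ (i : Fin d) → (lookup a i ≤ lookup x i) × (lookup x i ≤ lookup b i)

Subset : ℕ → Set
Subset d = Point d → Bool

_∈_ : ∀ {d} → Point d → Subset d → Set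
x ∈ S = T (S x)

_⊆_ : ∀ {d} → Subset d → Subset d → Set
S ⊆ S' = ∀ x → x ∈ S → x ∈ S'

SubM : ∀ {d} → Vec ℕ d → Subset d → Set
SubM ℓ S = ∀ x → x ∈ S → InM ℓ x

_∖_ : ∀ {d} → Subset d → Subset d → Subset d
(S ∖ S') x = S x ∧ not (S' x)

_∪_ : ∀ {d} → Subset d → Subset d → Subset d
(S ∪ S') x = S x ∨ S' x

_∩_ : ∀ {d} → Subset d → Subset d → Subset d
(S ∩ S') x = S x ∧ S' x

IsDownClosed : ∀ {d} → Subset d → Set
IsDownClosed S = ∀ x y → x ≤ᵖ y → y ∈ S → x ∈ S

IsDownset : ∀ {d} → Vec ℕ d → Subset d → Set
IsDownset ℓ S = SubM ℓ S × IsDownClosed S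

card : ∀ {d} → Vec ℕ d → Subset d → ℕ
card ℓ S = length (filter (λ x → T? (S x)) (box ℓ))

module Weights {c ℓ' : Level} (G : OrdAbGroup c ℓ') where
  open OrdAbGroup G

  wtSet : ∀ {d} → Vec ℕ d → (Point d → Carrier) → Subset d → Carrier
  wtSet ℓ wt S = foldr (λ x acc → if S x then wt x +ᴳ acc else acc) 0ᴳ (box ℓ)

  RankConstant : ∀ {d} → Vec ℕ d → (Point d → Carrier) → Set c
  RankConstant ℓ wt = ∀ x y → InM ℓ x → InM ℓ y → rank x ≡ rank y → wt x ≡ wt y

  RankIncreasing : ∀ {d} → Vec ℕ d → (Point d → Carrier) → Set (c ⊔ ℓ')
  RankIncreasing ℓ wt = ∀ x y → InM ℓ x → InM ℓ y → rank x < rank y → wt x <ᴳ wt y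

  Optimal : ∀ {d} → Vec ℕ d → (Point d → Carrier) → Subset d → Set ℓ'
  Optimal ℓ wt A = IsDownset ℓ A ×
    (∀ S → IsDownset ℓ S → card ℓ S ≡ card ℓ A → wtSet ℓ wt S ≤ᴳ wtSet ℓ wt A)

-- Reflection within Q = ∏[a_i,b_i] about {c₁,c₂}:
-- g_{c₁} = a_{c₁} + (f_{c₂} - a_{c₂}),  g_{c₂} = a_{c₂} + (f_{c₁} - a_{c₁}),
-- other coordinates unchanged.  (For f ∈ Q the truncated subtraction is the
-- ordinary one; if c₁ = c₂ this is the identity on Q.)

reflect : ∀ {d} → Vec ℕ d → Fin d → Fin d → Point d → Point d
reflect a c₁ c₂ f =
  (f [ c₁ ]≔ (lookup a c₁ + (lookup f c₂ ∸ lookup a c₂)))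
     [ c₂ ]≔ (lookup a c₂ + (lookup f c₁ ∸ lookup a c₁))

{-# OPTIONS --safe #-}

-- The weight of a subset of M is a sum over a duplicate-free enumeration of M, so it is
-- additive over disjoint unions: wt(A) = wt(A ∖ O) + wt(O) and
-- wt((A ∖ O) ∪ P) = wt(A ∖ O) + wt(P).  The reflection ρ is an involution of Q that
-- preserves rank, so it maps O bijectively onto R without changing weights (wt is rank
-- constant), while σ maps R bijectively onto P without decreasing them.  Hence
-- wt(O) = wt(R) ≤ wt(P), strictly if σ increases some weight, and the same bijections give
-- |(A ∖ O) ∪ P| = |A|; a strictly heavier downset of the same size rules out optimality of A.

module Submission where

open import Defs
open import Level using (Level)
open import Function using (_∘_)
open import Data.Nat using (ℕ; _+_; _∸_; _≤_; _<_)
open import Data.Nat.Properties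
  using ( m≤m+n; +-monoʳ-≤; ∸-monoˡ-≤; ≤-trans; ≤-reflexive; ≤-<-trans; m+[n∸m]≡n; m+n∸m≡n
        ; +-assoc; +-cancelʳ-≡; +-commutativeSemigroup)
open import Data.Nat.Tactic.RingSolver using (solve-∀)
open import Algebra.Properties.CommutativeSemigroup +-commutativeSemigroup
  using (xy∙z≈zy∙x; xy∙z≈xz∙y; x∙yz≈xz∙y)
open import Data.Bool using (true; false; T; if_then_else_)
open import Data.Bool.Properties using (T-irrelevant; T-∧; T-∨; T-not-≡)
open import Data.Fin using (Fin; zero; suc; _≟_)
open import Data.Vec using (Vec; []; _∷_; lookup; _[_]≔_)
import Data.Vec as Vec
open import Data.Vec.Properties
  using (lookup∘update; lookup∘update′; tabulate∘lookup; tabulate-cong; ∷-injective)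
open import Data.List
  using (List; []; _∷_; _++_; map; foldr; filter; upTo; concatMap; cartesianProductWith)
open import Data.List.Properties using (length-++; length-map; map-++; map-∘; map-cong-local)
open import Data.List.Membership.Propositional using () renaming (_∈_ to _∈ₗ_)
open import Data.List.Membership.Propositional.Properties
  using (∈-map⁺; ∈-map⁻; ∈-filter⁺; ∈-filter⁻; ∈-++⁻; ∈-++⁺ˡ; ∈-++⁺ʳ; ∈-upTo⁺; ∈-cartesianProductWith⁺)
open import Data.List.Membership.Propositional.Properties.WithK using (unique∧set⇒bag)
import Data.List.Relation.Unary.All as All
import Data.List.Relation.Unary.All.Properties as All
open import Data.List.Relation.Unary.Any using (here; there)
open import Data.List.Relation.Unary.AllPairs using ([]; _∷_)
open import Data.List.Relation.Unary.Unique.Propositional using (Unique)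
import Data.List.Relation.Unary.Unique.Propositional.Properties as Unique
open import Data.List.Relation.Binary.BagAndSetEquality using (∼bag⇒↭)
open import Data.List.Relation.Binary.Permutation.Propositional using (_↭_; ↭⇒↭ₛ)
open import Data.List.Relation.Binary.Permutation.Propositional.Properties
  using (↭-length) renaming (map⁺ to ↭-map⁺)
open import Data.List.Relation.Binary.Permutation.Setoid.Properties using (foldr-commMonoid)
open import Data.Product using (Σ; ∃; _×_; _,_; proj₁; proj₂)
open import Data.Empty using (⊥-elim)
open import Data.Sum using (_⊎_; inj₁; inj₂)
open import Function.Bundles using (_⤖_; _⇔_; Bijection; Equivalence; mk⇔)
open import Relation.Nullary using (¬_; yes; no)
open import Relation.Nullary.Decidable using (T?)
open import Relation.Binary.PropositionalEquality
open import Relation.Binary using (IsTotalOrder)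
open import Algebra.Bundles using (Group)
open import Algebra.Structures using (IsAbelianGroup)
import Algebra.Properties.Group as GroupProperties

Unique-⇔⇒↭ : ∀ {a} {X : Set a} {xs ys : List X} → Unique xs → Unique ys →
             (∀ {z} → z ∈ₗ xs ⇔ z ∈ₗ ys) → xs ↭ ys
Unique-⇔⇒↭ xs! ys! xs⇔ys = ∼bag⇒↭ (unique∧set⇒bag xs! ys! xs⇔ys)

module _ {a b} {X : Set a} {Y : Set b} {f : X → Y} where

  Unique-map⁺ : ∀ {xs} → (∀ {x y} → x ∈ₗ xs → y ∈ₗ xs → f x ≡ f y → x ≡ y) →
                Unique xs → Unique (map f xs)
  Unique-map⁺ inj [] = []
  Unique-map⁺ inj (x∉xs ∷ xs!) =
    All.map⁺ (All.tabulate λ y∈xs fx≡fy → All.lookup x∉xs y∈xs (inj (here refl) (there y∈xs) fx≡fy))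
    ∷ Unique-map⁺ (λ x∈xs y∈xs → inj (there x∈xs) (there y∈xs)) xs!

  map-↭ : ∀ {xs ys} → Unique xs → Unique ys →
          (∀ {x y} → x ∈ₗ xs → y ∈ₗ xs → f x ≡ f y → x ≡ y) →
          (∀ {y} → y ∈ₗ ys ⇔ ∃ λ x → x ∈ₗ xs × f x ≡ y) →
          map f xs ↭ ys
  map-↭ {xs} {ys} xs! ys! inj image = Unique-⇔⇒↭ (Unique-map⁺ inj xs!) ys! (mk⇔ to from)
    where
    to : ∀ {y} → y ∈ₗ map f xs → y ∈ₗ ys
    to y∈fxs with x , x∈xs , refl ← ∈-map⁻ f y∈fxs = Equivalence.from image (x , x∈xs , refl)
    from : ∀ {y} → y ∈ₗ ys → y ∈ₗ map f xs
    from y∈ys with x , x∈xs , refl ← Equivalence.to image y∈ys = ∈-map⁺ f x∈xs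

concatMap-map≡cartesianProductWith : ∀ {a b c} {X : Set a} {Y : Set b} {Z : Set c}
  (f : X → Y → Z) xs (ys : List Y) → concatMap (λ x → map (f x) ys) xs ≡ cartesianProductWith f xs ys
concatMap-map≡cartesianProductWith f []       ys = refl
concatMap-map≡cartesianProductWith f (x ∷ xs) ys =
  cong (map (f x) ys ++_) (concatMap-map≡cartesianProductWith f xs ys)

box-∷ : ∀ {d} l (ℓ : Vec ℕ d) → box (l ∷ ℓ) ≡ cartesianProductWith _∷_ (upTo l) (box ℓ)
box-∷ l ℓ = concatMap-map≡cartesianProductWith _∷_ (upTo l) (box ℓ)

box-unique : ∀ {d} (ℓ : Vec ℕ d) → Unique (box ℓ)
box-unique []      = All.[] ∷ []
box-unique (l ∷ ℓ) = subst Unique (sym (box-∷ l ℓ))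
  (Unique.cartesianProductWith⁺ _∷_ ∷-injective (Unique.upTo⁺ l) (box-unique ℓ))

∈-box⁺ : ∀ {d} (ℓ : Vec ℕ d) {x} → InM ℓ x → x ∈ₗ box ℓ
∈-box⁺ []      {[]}     _   = here refl
∈-box⁺ (l ∷ ℓ) {x ∷ xs} x∈M = subst (x ∷ xs ∈ₗ_) (sym (box-∷ l ℓ))
  (∈-cartesianProductWith⁺ _∷_ (∈-upTo⁺ (x∈M zero)) (∈-box⁺ ℓ (x∈M ∘ suc)))

∖-disjoint : ∀ {d} {S S' : Subset d} x → x ∈ (S ∖ S') → ¬ x ∈ S'
∖-disjoint {S = S} {S'} x x∈S∖S' x∈S' =
  subst T (Equivalence.to T-not-≡ (proj₂ (Equivalence.to (T-∧ {S x}) x∈S∖S'))) x∈S'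

∖-∪-split : ∀ {d} {S S' : Subset d} → S' ⊆ S → ∀ x → x ∈ S ⇔ (x ∈ (S ∖ S') ⊎ x ∈ S')
∖-∪-split {S = S} {S'} S'⊆S x with S x | S' x | S'⊆S x
... | true  | true  | _    = mk⇔ inj₂ (λ _ → _)
... | true  | false | _    = mk⇔ inj₁ (λ _ → _)
... | false | true  | S'⊆S = ⊥-elim (S'⊆S _)
... | false | false | _    = mk⇔ (λ ()) λ { (inj₁ ()) ; (inj₂ ()) }

module _ {d} (ℓ : Vec ℕ d) where

  elements : Subset d → List (Point d)
  elements S = filter (λ x → T? (S x)) (box ℓ)

  elements-unique : ∀ S → Unique (elements S)
  elements-unique S = Unique.filter⁺ (λ x → T? (S x)) (box-unique ℓ)

  ∈-elements⁻ : ∀ S {x} → x ∈ₗ elements S → x ∈ₗ box ℓ × x ∈ S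
  ∈-elements⁻ S = ∈-filter⁻ (λ x → T? (S x)) {xs = box ℓ}

  ∈-elements⁺ : ∀ S {x} → x ∈ₗ box ℓ → x ∈ S → x ∈ₗ elements S
  ∈-elements⁺ S = ∈-filter⁺ (λ x → T? (S x))

  elements-split : ∀ {S S₁ S₂} → (∀ x → x ∈ S₁ → ¬ x ∈ S₂) →
                   (∀ x → x ∈ S ⇔ (x ∈ S₁ ⊎ x ∈ S₂)) →
                   elements S ↭ elements S₁ ++ elements S₂
  elements-split {S} {S₁} {S₂} disjoint S⇔S₁⊎S₂ =
    Unique-⇔⇒↭ (elements-unique S)
      (Unique.++⁺ (elements-unique S₁) (elements-unique S₂)
        λ (x∈S₁ , x∈S₂) → disjoint _ (proj₂ (∈-elements⁻ S₁ x∈S₁)) (proj₂ (∈-elements⁻ S₂ x∈S₂)))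
      (mk⇔ to from)
    where
    to : ∀ {x} → x ∈ₗ elements S → x ∈ₗ elements S₁ ++ elements S₂
    to x∈ with x∈box , x∈S ← ∈-elements⁻ S x∈ with Equivalence.to (S⇔S₁⊎S₂ _) x∈S
    ... | inj₁ x∈S₁ = ∈-++⁺ˡ (∈-elements⁺ S₁ x∈box x∈S₁)
    ... | inj₂ x∈S₂ = ∈-++⁺ʳ (elements S₁) (∈-elements⁺ S₂ x∈box x∈S₂)
    from : ∀ {x} → x ∈ₗ elements S₁ ++ elements S₂ → x ∈ₗ elements S
    from x∈ with ∈-++⁻ (elements S₁) x∈
    ... | inj₁ x∈₁ with x∈box , x∈S₁ ← ∈-elements⁻ S₁ x∈₁ =
      ∈-elements⁺ S x∈box (Equivalence.from (S⇔S₁⊎S₂ _) (inj₁ x∈S₁))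
    ... | inj₂ x∈₂ with x∈box , x∈S₂ ← ∈-elements⁻ S₂ x∈₂ =
      ∈-elements⁺ S x∈box (Equivalence.from (S⇔S₁⊎S₂ _) (inj₂ x∈S₂))

  card-split : ∀ {S S₁ S₂} → (∀ x → x ∈ S₁ → ¬ x ∈ S₂) → (∀ x → x ∈ S ⇔ (x ∈ S₁ ⊎ x ∈ S₂)) →
               card ℓ S ≡ card ℓ S₁ + card ℓ S₂
  card-split {S₁ = S₁} disjoint S⇔S₁⊎S₂ =
    trans (↭-length (elements-split disjoint S⇔S₁⊎S₂)) (length-++ (elements S₁))

  elements-image : ∀ {S S' f} → SubM ℓ S → SubM ℓ S' →
                   (∀ {x y} → x ∈ S → y ∈ S → f x ≡ f y → x ≡ y) →
                   (∀ y → y ∈ S' ⇔ ∃ λ x → x ∈ S × f x ≡ y) →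
                   map f (elements S) ↭ elements S'
  elements-image {S} {S'} {f} S⊆M S'⊆M inj image =
    map-↭ (elements-unique S) (elements-unique S')
      (λ x∈ y∈ → inj (proj₂ (∈-elements⁻ S x∈)) (proj₂ (∈-elements⁻ S y∈))) (mk⇔ to from)
    where
    to : ∀ {y} → y ∈ₗ elements S' → ∃ λ x → x ∈ₗ elements S × f x ≡ y
    to y∈ with x , x∈S , fx≡y ← Equivalence.to (image _) (proj₂ (∈-elements⁻ S' y∈)) =
      x , ∈-elements⁺ S (∈-box⁺ ℓ (S⊆M x x∈S)) x∈S , fx≡y
    from : ∀ {y} → (∃ λ x → x ∈ₗ elements S × f x ≡ y) → y ∈ₗ elements S'
    from (x , x∈ , fx≡y) with y∈S' ← Equivalence.from (image _) (x , proj₂ (∈-elements⁻ S x∈) , fx≡y) =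
      ∈-elements⁺ S' (∈-box⁺ ℓ (S'⊆M _ y∈S')) y∈S'

  card-image : ∀ {S S' f} → SubM ℓ S → SubM ℓ S' →
               (∀ {x y} → x ∈ S → y ∈ S → f x ≡ f y → x ≡ y) →
               (∀ y → y ∈ S' ⇔ ∃ λ x → x ∈ S × f x ≡ y) →
               card ℓ S' ≡ card ℓ S
  card-image {S} {f = f} S⊆M S'⊆M inj image =
    trans (sym (↭-length (elements-image S⊆M S'⊆M inj image))) (length-map f (elements S))

lookup-ext : ∀ {a} {X : Set a} {n} {xs ys : Vec X n} → (∀ i → lookup xs i ≡ lookup ys i) → xs ≡ ys
lookup-ext {xs = xs} {ys} xs≗ys =
  trans (sym (tabulate∘lookup xs)) (trans (tabulate-cong xs≗ys) (tabulate∘lookup ys))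

sum-[]≔ : ∀ {n} (v : Vec ℕ n) i x → Vec.sum (v [ i ]≔ x) + lookup v i ≡ Vec.sum v + x
sum-[]≔ (y ∷ v) zero    x = xy∙z≈zy∙x x (Vec.sum v) y
sum-[]≔ (y ∷ v) (suc i) x = begin
  y + Vec.sum (v [ i ]≔ x) + lookup v i   ≡⟨ +-assoc y (Vec.sum (v [ i ]≔ x)) (lookup v i) ⟩
  y + (Vec.sum (v [ i ]≔ x) + lookup v i) ≡⟨ cong (y +_) (sum-[]≔ v i x) ⟩
  y + (Vec.sum v + x)                     ≡⟨ +-assoc y (Vec.sum v) x ⟨
  y + Vec.sum v + x                       ∎
  where open ≡-Reasoning

sum-[]≔-[]≔ : ∀ {n} (v : Vec ℕ n) {i j} → i ≢ j → ∀ x y →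
  Vec.sum ((v [ i ]≔ x) [ j ]≔ y) + (lookup v i + lookup v j) ≡ Vec.sum v + (x + y)
sum-[]≔-[]≔ v {i} {j} i≢j x y = begin
  Vec.sum v″ + (lookup v i + lookup v j) ≡⟨ x∙yz≈xz∙y (Vec.sum v″) (lookup v i) (lookup v j) ⟩
  Vec.sum v″ + lookup v j + lookup v i   ≡⟨ cong (λ z → Vec.sum v″ + z + lookup v i) v′ⱼ≡vⱼ ⟨
  Vec.sum v″ + lookup v′ j + lookup v i  ≡⟨ cong (_+ lookup v i) (sum-[]≔ v′ j y) ⟩
  Vec.sum v′ + y + lookup v i            ≡⟨ xy∙z≈xz∙y (Vec.sum v′) y (lookup v i) ⟩
  Vec.sum v′ + lookup v i + y            ≡⟨ cong (_+ y) (sum-[]≔ v i x) ⟩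
  Vec.sum v + x + y                      ≡⟨ +-assoc (Vec.sum v) x y ⟩
  Vec.sum v + (x + y)                    ∎
  where
  open ≡-Reasoning
  v′ v″ : Vec ℕ _
  v′ = v [ i ]≔ x
  v″ = v′ [ j ]≔ y
  v′ⱼ≡vⱼ : lookup v′ j ≡ lookup v j
  v′ⱼ≡vⱼ = lookup∘update′ (i≢j ∘ sym) v x

+-exchange : ∀ m n o p → (m + n) + (o + p) ≡ (m + p) + (o + n)
+-exchange = solve-∀

module Reflection {d} (a b : Vec ℕ d) (c₁ c₂ : Fin d) where

  ρ : Point d → Point d
  ρ = reflect a c₁ c₂

  private
    ρ₁ : Point d → Point d
    ρ₁ f = f [ c₁ ]≔ (lookup a c₁ + (lookup f c₂ ∸ lookup a c₂))

  lookup-ρ₂ : ∀ f → lookup (ρ f) c₂ ≡ lookup a c₂ + (lookup f c₁ ∸ lookup a c₁)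
  lookup-ρ₂ f = lookup∘update c₂ (ρ₁ f) _

  lookup-ρ₁ : ∀ f → lookup (ρ f) c₁ ≡ lookup a c₁ + (lookup f c₂ ∸ lookup a c₂)
  -- For c₁ = c₂ the second update of reflect overwrites the first.
  lookup-ρ₁ f with c₁ ≟ c₂
  ... | yes c₁≡c₂ = trans (cong (lookup (ρ f)) c₁≡c₂) (trans (lookup-ρ₂ f)
                      (cong₂ (λ c c′ → lookup a c + (lookup f c′ ∸ lookup a c′)) (sym c₁≡c₂) c₁≡c₂))
  ... | no c₁≢c₂ = trans (lookup∘update′ c₁≢c₂ (ρ₁ f) _) (lookup∘update c₁ f _)

  lookup-ρ-other : ∀ f {i} → i ≢ c₁ → i ≢ c₂ → lookup (ρ f) i ≡ lookup f i
  lookup-ρ-other f i≢c₁ i≢c₂ = trans (lookup∘update′ i≢c₂ (ρ₁ f) _) (lookup∘update′ i≢c₁ f _)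

  private
    offset-within : ∀ {a′ b′ x a″ b″} → a′ ≤ x × x ≤ b′ → b′ ∸ a′ ≡ b″ ∸ a″ → a″ ≤ b″ →
                    a″ ≤ a″ + (x ∸ a′) × a″ + (x ∸ a′) ≤ b″
    offset-within {a′} {a″ = a″} (_ , x≤b′) widths a″≤b″ =
      m≤m+n a″ _ ,
      ≤-trans (+-monoʳ-≤ a″ (∸-monoˡ-≤ a′ x≤b′))
              (≤-reflexive (trans (cong (a″ +_) widths) (m+[n∸m]≡n a″≤b″)))

    offset-undo : ∀ {a′ a″ x y} → y ≡ a′ + (x ∸ a″) → a″ ≤ x → a″ + (y ∸ a′) ≡ x
    offset-undo {a′} {a″} {x} refl a″≤x = trans (cong (a″ +_) (m+n∸m≡n a′ (x ∸ a″))) (m+[n∸m]≡n a″≤x)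

  ρ-InQ : lookup b c₁ ∸ lookup a c₁ ≡ lookup b c₂ ∸ lookup a c₂ →
          ∀ f → InQ a b f → InQ a b (ρ f)
  ρ-InQ widths f f∈Q i with i ≟ c₁ | i ≟ c₂
  ... | yes refl | _ = subst (λ v → lookup a i ≤ v × v ≤ lookup b i) (sym (lookup-ρ₁ f))
    (offset-within (f∈Q c₂) (sym widths) (≤-trans (proj₁ (f∈Q c₁)) (proj₂ (f∈Q c₁))))
  ... | no _ | yes refl = subst (λ v → lookup a i ≤ v × v ≤ lookup b i) (sym (lookup-ρ₂ f))
    (offset-within (f∈Q c₁) widths (≤-trans (proj₁ (f∈Q c₂)) (proj₂ (f∈Q c₂))))
  ... | no i≢c₁ | no i≢c₂ = subst (λ v → lookup a i ≤ v × v ≤ lookup b i)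
    (sym (lookup-ρ-other f i≢c₁ i≢c₂)) (f∈Q i)

  ρ-involutive : ∀ {f} → InQ a b f → ρ (ρ f) ≡ f
  ρ-involutive {f} f∈Q = lookup-ext ρρf≗f
    where
    ρρf≗f : ∀ i → lookup (ρ (ρ f)) i ≡ lookup f i
    ρρf≗f i with i ≟ c₁ | i ≟ c₂
    ... | yes refl | _ = trans (lookup-ρ₁ (ρ f)) (offset-undo (lookup-ρ₂ f) (proj₁ (f∈Q i)))
    ... | no _ | yes refl = trans (lookup-ρ₂ (ρ f)) (offset-undo (lookup-ρ₁ f) (proj₁ (f∈Q i)))
    ... | no i≢c₁ | no i≢c₂ = trans (lookup-ρ-other (ρ f) i≢c₁ i≢c₂) (lookup-ρ-other f i≢c₁ i≢c₂)

  ρ-injectiveOnQ : ∀ {f g} → InQ a b f → InQ a b g → ρ f ≡ ρ g → f ≡ g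
  ρ-injectiveOnQ f∈Q g∈Q ρf≡ρg =
    trans (sym (ρ-involutive f∈Q)) (trans (cong ρ ρf≡ρg) (ρ-involutive g∈Q))

  ρ-diagonal : c₁ ≡ c₂ → ∀ f → InQ a b f → ρ f ≡ f
  ρ-diagonal c₁≡c₂ f f∈Q = lookup-ext ρf≗f
    where
    ρf≗f : ∀ i → lookup (ρ f) i ≡ lookup f i
    ρf≗f i with i ≟ c₂
    ... | yes refl = trans (lookup-ρ₂ f)
      (trans (cong (λ c → lookup a i + (lookup f c ∸ lookup a c)) c₁≡c₂) (m+[n∸m]≡n (proj₁ (f∈Q i))))
    ... | no i≢c₂ = lookup-ρ-other f (λ i≡c₁ → i≢c₂ (trans i≡c₁ c₁≡c₂)) i≢c₂

  rank-ρ : ∀ f → InQ a b f → rank (ρ f) ≡ rank f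
  rank-ρ f f∈Q with c₁ ≟ c₂
  ... | yes c₁≡c₂ = cong rank (ρ-diagonal c₁≡c₂ f f∈Q)
  ... | no c₁≢c₂ = +-cancelʳ-≡ (lookup f c₁ + lookup f c₂) (rank (ρ f)) (rank f)
    (trans (sum-[]≔-[]≔ f c₁≢c₂ _ _) (cong (rank f +_) u+w≡f₁+f₂))
    where
    u+w≡f₁+f₂ : (lookup a c₁ + (lookup f c₂ ∸ lookup a c₂)) + (lookup a c₂ + (lookup f c₁ ∸ lookup a c₁))
                ≡ lookup f c₁ + lookup f c₂
    u+w≡f₁+f₂ = trans (+-exchange (lookup a c₁) _ (lookup a c₂) _)
      (cong₂ _+_ (m+[n∸m]≡n (proj₁ (f∈Q c₁))) (m+[n∸m]≡n (proj₁ (f∈Q c₂))))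

module _ {d} {R P : Subset d} (σ : Σ (Point d) (λ x → x ∈ R) ⤖ Σ (Point d) (λ x → x ∈ P)) where

  open Bijection σ using (to; injective; surjective)

  extend : Point d → Point d
  extend x with T? (R x)
  ... | yes x∈R = proj₁ (to (x , x∈R))
  ... | no _    = x

  extend-to : ∀ {x} (x∈R : x ∈ R) → extend x ≡ proj₁ (to (x , x∈R))
  extend-to {x} x∈R with T? (R x)
  ... | yes x∈R′ = cong (λ p → proj₁ (to (x , p))) (T-irrelevant x∈R′ x∈R)
  ... | no x∉R   = ⊥-elim (x∉R x∈R)

  extend-injectiveOn : ∀ {x y} → x ∈ R → y ∈ R → extend x ≡ extend y → x ≡ y
  extend-injectiveOn x∈R y∈R eq =
    cong proj₁ (injective (Σ-≡ (trans (sym (extend-to x∈R)) (trans eq (extend-to y∈R)))))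
    where
    Σ-≡ : ∀ {u v : Σ (Point d) (λ x → x ∈ P)} → proj₁ u ≡ proj₁ v → u ≡ v
    Σ-≡ {x , p} {.x , q} refl = cong (x ,_) (T-irrelevant p q)

  extend-image : ∀ y → y ∈ P ⇔ ∃ λ x → x ∈ R × extend x ≡ y
  extend-image y = mk⇔ from-P to-P
    where
    from-P : y ∈ P → ∃ λ x → x ∈ R × extend x ≡ y
    from-P y∈P with (x , x∈R) , to≡ ← surjective (y , y∈P) =
      x , x∈R , trans (extend-to x∈R) (cong proj₁ (to≡ refl))
    to-P : (∃ λ x → x ∈ R × extend x ≡ y) → y ∈ P
    to-P (x , x∈R , refl) = subst (_∈ P) (sym (extend-to x∈R)) (proj₂ (to (x , x∈R)))

module OrderedSums {c ℓ'} (G : OrdAbGroup c ℓ') where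

  open OrdAbGroup G
  open Weights G

  private
    module ≤ = IsTotalOrder isTotalOrder
    open IsAbelianGroup isAbelianGroup using (assoc; comm; identityˡ; isCommutativeMonoid; isGroup)

    group : Group c c
    group = record { isGroup = isGroup }

    open GroupProperties group using (∙-cancelʳ)

  +ᴳ-mono-≤ : ∀ {x y u v} → x ≤ᴳ y → u ≤ᴳ v → x +ᴳ u ≤ᴳ y +ᴳ v
  +ᴳ-mono-≤ {y = y} {u} {v} x≤y u≤v =
    ≤.trans (+-mono-≤ u x≤y) (subst₂ _≤ᴳ_ (comm u y) (comm v y) (+-mono-≤ y u≤v))

  +ᴳ-mono-<-≤ : ∀ {x y u v} → x <ᴳ y → u ≤ᴳ v → x +ᴳ u <ᴳ y +ᴳ v
  +ᴳ-mono-<-≤ {x} {y} {u} (x≤y , x≢y) u≤v = +ᴳ-mono-≤ x≤y u≤v , λ x+u≡y+v →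
    x≢y (∙-cancelʳ u x y (≤.antisym (+-mono-≤ u x≤y)
      (subst (y +ᴳ u ≤ᴳ_) (sym x+u≡y+v) (+ᴳ-mono-≤ ≤.refl u≤v))))

  +ᴳ-mono-≤-< : ∀ {x y u v} → x ≤ᴳ y → u <ᴳ v → x +ᴳ u <ᴳ y +ᴳ v
  +ᴳ-mono-≤-< {x} {y} {u} {v} x≤y u<v = subst₂ _<ᴳ_ (comm u x) (comm v y) (+ᴳ-mono-<-≤ u<v x≤y)

  ∑ : List Carrier → Carrier
  ∑ = foldr _+ᴳ_ 0ᴳ

  ∑-++ : ∀ xs ys → ∑ (xs ++ ys) ≡ ∑ xs +ᴳ ∑ ys
  ∑-++ []       ys = sym (identityˡ (∑ ys))
  ∑-++ (x ∷ xs) ys = trans (cong (x +ᴳ_) (∑-++ xs ys)) (sym (assoc x (∑ xs) (∑ ys)))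

  ∑-↭ : ∀ {xs ys} → xs ↭ ys → ∑ xs ≡ ∑ ys
  ∑-↭ xs↭ys = foldr-commMonoid (setoid Carrier) isCommutativeMonoid (↭⇒↭ₛ xs↭ys)

  module _ {a} {X : Set a} {g h : X → Carrier} where

    ∑-map-≤ : ∀ xs → (∀ {x} → x ∈ₗ xs → g x ≤ᴳ h x) → ∑ (map g xs) ≤ᴳ ∑ (map h xs)
    ∑-map-≤ []       _   = ≤.refl
    ∑-map-≤ (x ∷ xs) g≤h = +ᴳ-mono-≤ (g≤h (here refl)) (∑-map-≤ xs (g≤h ∘ there))

    ∑-map-< : ∀ xs → (∀ {x} → x ∈ₗ xs → g x ≤ᴳ h x) →
              ∀ {z} → z ∈ₗ xs → g z <ᴳ h z → ∑ (map g xs) <ᴳ ∑ (map h xs)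
    ∑-map-< (x ∷ xs) g≤h (here refl) gx<hx = +ᴳ-mono-<-≤ gx<hx (∑-map-≤ xs (g≤h ∘ there))
    ∑-map-< (x ∷ xs) g≤h (there z∈xs) gz<hz =
      +ᴳ-mono-≤-< (g≤h (here refl)) (∑-map-< xs (g≤h ∘ there) z∈xs gz<hz)

  module _ {d} (ℓ : Vec ℕ d) (wt : Point d → Carrier) where

    wtSet-elements : ∀ S → wtSet ℓ wt S ≡ ∑ (map wt (elements ℓ S))
    wtSet-elements S = fold≡∑ (box ℓ)
      where
      fold≡∑ : ∀ xs → foldr (λ x acc → if S x then wt x +ᴳ acc else acc) 0ᴳ xs
                  ≡ ∑ (map wt (filter (λ x → T? (S x)) xs))
      fold≡∑ []       = refl
      fold≡∑ (x ∷ xs) with S x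
      ... | true  = cong (wt x +ᴳ_) (fold≡∑ xs)
      ... | false = fold≡∑ xs

    wtSet-split : ∀ {S S₁ S₂} → (∀ x → x ∈ S₁ → ¬ x ∈ S₂) → (∀ x → x ∈ S ⇔ (x ∈ S₁ ⊎ x ∈ S₂)) →
                  wtSet ℓ wt S ≡ wtSet ℓ wt S₁ +ᴳ wtSet ℓ wt S₂
    wtSet-split {S} {S₁} {S₂} disjoint S⇔S₁⊎S₂ = begin
      wtSet ℓ wt S                             ≡⟨ wtSet-elements S ⟩
      ∑ (map wt (elements ℓ S))                ≡⟨ ∑-↭ (↭-map⁺ wt (elements-split ℓ disjoint S⇔S₁⊎S₂)) ⟩
      ∑ (map wt (xs₁ ++ xs₂))                  ≡⟨ cong ∑ (map-++ wt xs₁ xs₂) ⟩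
      ∑ (map wt xs₁ ++ map wt xs₂)             ≡⟨ ∑-++ (map wt xs₁) (map wt xs₂) ⟩
      ∑ (map wt xs₁) +ᴳ ∑ (map wt xs₂)         ≡⟨ cong₂ _+ᴳ_ (wtSet-elements S₁) (wtSet-elements S₂) ⟨
      wtSet ℓ wt S₁ +ᴳ wtSet ℓ wt S₂           ∎
      where
      open ≡-Reasoning
      xs₁ xs₂ : List (Point d)
      xs₁ = elements ℓ S₁
      xs₂ = elements ℓ S₂

    wtSet-image : ∀ {S S' f} → SubM ℓ S → SubM ℓ S' →
                  (∀ {x y} → x ∈ S → y ∈ S → f x ≡ f y → x ≡ y) →
                  (∀ y → y ∈ S' ⇔ ∃ λ x → x ∈ S × f x ≡ y) →
                  wtSet ℓ wt S' ≡ ∑ (map (wt ∘ f) (elements ℓ S))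
    wtSet-image {S} {S'} {f} S⊆M S'⊆M inj image = begin
      wtSet ℓ wt S'                       ≡⟨ wtSet-elements S' ⟩
      ∑ (map wt (elements ℓ S'))          ≡⟨ ∑-↭ (↭-map⁺ wt (elements-image ℓ S⊆M S'⊆M inj image)) ⟨
      ∑ (map wt (map f (elements ℓ S)))   ≡⟨ cong ∑ (map-∘ (elements ℓ S)) ⟨
      ∑ (map (wt ∘ f) (elements ℓ S))     ∎
      where open ≡-Reasoning

    module _ {R P : Subset d} (R⊆M : SubM ℓ R) (P⊆M : SubM ℓ P)
             (σ : Σ (Point d) (λ x → x ∈ R) ⤖ Σ (Point d) (λ x → x ∈ P)) where

      open Bijection σ using (to)

      private
        wtSet-P : wtSet ℓ wt P ≡ ∑ (map (wt ∘ extend σ) (elements ℓ R))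
        wtSet-P = wtSet-image R⊆M P⊆M (extend-injectiveOn σ) (extend-image σ)

        wt-extend : ∀ {x} (x∈R : x ∈ R) → wt (extend σ x) ≡ wt (proj₁ (to (x , x∈R)))
        wt-extend x∈R = cong wt (extend-to σ x∈R)

        wt≤wt∘extend : (∀ f → wt (proj₁ f) ≤ᴳ wt (proj₁ (to f))) →
                       ∀ {x} → x ∈ₗ elements ℓ R → wt x ≤ᴳ wt (extend σ x)
        wt≤wt∘extend wt≤ {x} x∈ with x∈R ← proj₂ (∈-elements⁻ ℓ R x∈) =
          subst (wt x ≤ᴳ_) (sym (wt-extend x∈R)) (wt≤ (_ , x∈R))

      wtSet-⤖-≤ : (∀ f → wt (proj₁ f) ≤ᴳ wt (proj₁ (to f))) → wtSet ℓ wt R ≤ᴳ wtSet ℓ wt P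
      wtSet-⤖-≤ wt≤ = subst₂ _≤ᴳ_ (sym (wtSet-elements R)) (sym wtSet-P)
        (∑-map-≤ (elements ℓ R) (wt≤wt∘extend wt≤))

      wtSet-⤖-< : (∀ f → wt (proj₁ f) ≤ᴳ wt (proj₁ (to f))) →
                  (∃ λ f → wt (proj₁ f) <ᴳ wt (proj₁ (to f))) → wtSet ℓ wt R <ᴳ wtSet ℓ wt P
      wtSet-⤖-< wt≤ ((x , x∈R) , wt<) = subst₂ _<ᴳ_ (sym (wtSet-elements R)) (sym wtSet-P)
        (∑-map-< (elements ℓ R) (wt≤wt∘extend wt≤) (∈-elements⁺ ℓ R (∈-box⁺ ℓ (R⊆M x x∈R)) x∈R)
          (subst (wt x <ᴳ_) (sym (wt-extend x∈R)) wt<))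

    heavier⇒¬Optimal : ∀ {A S} → IsDownset ℓ S → card ℓ S ≡ card ℓ A →
                       wtSet ℓ wt A <ᴳ wtSet ℓ wt S → ¬ Optimal ℓ wt A
    heavier⇒¬Optimal S↓ |S|≡|A| (A≤S , A≢S) (_ , optimal) = A≢S (≤.antisym A≤S (optimal _ S↓ |S|≡|A|))

    module Exchange
      {A O R P : Subset d} {ρ : Point d → Point d}
      (A⊆M : SubM ℓ A) (O⊆A : O ⊆ A) (R⊆M : SubM ℓ R) (P⊆M : SubM ℓ P) (P∩A≡∅ : ∀ x → x ∈ P → ¬ x ∈ A)
      (ρ-injectiveOnO : ∀ {x y} → x ∈ O → y ∈ O → ρ x ≡ ρ y → x ≡ y)
      (R-image : ∀ y → y ∈ R ⇔ ∃ λ x → x ∈ O × ρ x ≡ y)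
      (wt∘ρ : ∀ {x} → x ∈ O → wt (ρ x) ≡ wt x)
      (σ : Σ (Point d) (λ x → x ∈ R) ⤖ Σ (Point d) (λ x → x ∈ P))
      (wt≤wt∘σ : ∀ f → wt (proj₁ f) ≤ᴳ wt (proj₁ (Bijection.to σ f)))
      where

      private
        O⊆M : SubM ℓ O
        O⊆M x x∈O = A⊆M x (O⊆A x x∈O)

        A∖O-disjoint-P : ∀ x → x ∈ (A ∖ O) → ¬ x ∈ P
        A∖O-disjoint-P x x∈A∖O x∈P = P∩A≡∅ x x∈P (proj₁ (Equivalence.to (T-∧ {A x}) x∈A∖O))

        wtSet-A : wtSet ℓ wt A ≡ wtSet ℓ wt (A ∖ O) +ᴳ wtSet ℓ wt O
        wtSet-A = wtSet-split ∖-disjoint (∖-∪-split O⊆A)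

        wtSet-A′ : wtSet ℓ wt ((A ∖ O) ∪ P) ≡ wtSet ℓ wt (A ∖ O) +ᴳ wtSet ℓ wt P
        wtSet-A′ = wtSet-split A∖O-disjoint-P (λ x → T-∨)

        wtSet-R : wtSet ℓ wt R ≡ wtSet ℓ wt O
        wtSet-R = trans (wtSet-image O⊆M R⊆M ρ-injectiveOnO R-image)
          (trans (cong ∑ (map-cong-local (All.tabulate λ x∈ → wt∘ρ (proj₂ (∈-elements⁻ ℓ O x∈)))))
                 (sym (wtSet-elements O)))

      card-exchange : card ℓ ((A ∖ O) ∪ P) ≡ card ℓ A
      card-exchange = begin
        card ℓ ((A ∖ O) ∪ P)       ≡⟨ card-split ℓ A∖O-disjoint-P (λ x → T-∨) ⟩
        card ℓ (A ∖ O) + card ℓ P  ≡⟨ cong (card ℓ (A ∖ O) +_) |P|≡|O| ⟩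
        card ℓ (A ∖ O) + card ℓ O  ≡⟨ card-split ℓ ∖-disjoint (∖-∪-split O⊆A) ⟨
        card ℓ A                   ∎
        where
        open ≡-Reasoning
        |P|≡|O| : card ℓ P ≡ card ℓ O
        |P|≡|O| = trans (card-image ℓ R⊆M P⊆M (extend-injectiveOn σ) (extend-image σ))
                        (card-image ℓ O⊆M R⊆M ρ-injectiveOnO R-image)

      wtSet-exchange-≤ : wtSet ℓ wt A ≤ᴳ wtSet ℓ wt ((A ∖ O) ∪ P)
      wtSet-exchange-≤ = subst₂ _≤ᴳ_ (sym wtSet-A) (sym wtSet-A′)
        (+ᴳ-mono-≤ ≤.refl (subst (_≤ᴳ wtSet ℓ wt P) wtSet-R (wtSet-⤖-≤ R⊆M P⊆M σ wt≤wt∘σ)))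

      wtSet-exchange-< : (∃ λ f → wt (proj₁ f) <ᴳ wt (proj₁ (Bijection.to σ f))) →
                         wtSet ℓ wt A <ᴳ wtSet ℓ wt ((A ∖ O) ∪ P)
      wtSet-exchange-< strict = subst₂ _<ᴳ_ (sym wtSet-A) (sym wtSet-A′)
        (+ᴳ-mono-≤-< ≤.refl (subst (_<ᴳ wtSet ℓ wt P) wtSet-R (wtSet-⤖-< R⊆M P⊆M σ wt≤wt∘σ strict)))

lemma3p11 : ∀ {c ℓ' : Level} (G : OrdAbGroup c ℓ') →
    let open OrdAbGroup G
        open Weights G
    in (d : ℕ) → 1 ≤ d → (ℓ : Vec ℕ d) → (∀ i → 1 ≤ lookup ℓ i) →
       (wt : Point d → Carrier) → RankIncreasing ℓ wt → RankConstant ℓ wt →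
       (A : Subset d) → IsDownset ℓ A →
       (a b : Vec ℕ d) → (∀ i → lookup a i ≤ lookup b i) → (∀ i → lookup b i < lookup ℓ i) →
       (O : Subset d) → (∀ x → x ∈ O → x ∈ A × InQ a b x) → IsDownset ℓ (A ∖ O) →
       (c₁ c₂ : Fin d) → lookup b c₁ ∸ lookup a c₁ ≡ lookup b c₂ ∸ lookup a c₂ →
       (R : Subset d) → (∀ y → y ∈ R ⇔ (∃ λ f → f ∈ O × reflect a c₁ c₂ f ≡ y)) →
       (P : Subset d) → SubM ℓ P → (∀ x → x ∈ P → ¬ (x ∈ A)) → IsDownset ℓ ((A ∖ O) ∪ P) →
       (σ : Σ (Point d) (λ x → x ∈ R) ⤖ Σ (Point d) (λ x → x ∈ P)) →
       (∀ f → wt (proj₁ f) ≤ᴳ wt (proj₁ (Bijection.to σ f))) →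
       (wtSet ℓ wt A ≤ᴳ wtSet ℓ wt ((A ∖ O) ∪ P)) ×
       ((∃ λ f → wt (proj₁ f) <ᴳ wt (proj₁ (Bijection.to σ f))) →
          (wtSet ℓ wt A <ᴳ wtSet ℓ wt ((A ∖ O) ∪ P)) × ¬ Optimal ℓ wt A)
lemma3p11 G d _ ℓ _ wt _ rank-constant A (A⊆M , _) a b _ b<ℓ O O⊆A∩Q _ c₁ c₂ widths R R-image
          P P⊆M P∩A≡∅ A′-downset σ wt≤wt∘σ =
  wtSet-exchange-≤ , λ strict → wtSet-exchange-< strict ,
    heavier⇒¬Optimal ℓ wt A′-downset card-exchange (wtSet-exchange-< strict)
  where
  open OrderedSums G
  open Reflection a b c₁ c₂

  Q⊆M : ∀ x → InQ a b x → InM ℓ x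
  Q⊆M x x∈Q i = ≤-<-trans (proj₂ (x∈Q i)) (b<ℓ i)

  O⊆Q : ∀ {x} → x ∈ O → InQ a b x
  O⊆Q {x} x∈O = proj₂ (O⊆A∩Q x x∈O)

  ρO⊆M : ∀ {x} → x ∈ O → InM ℓ (ρ x)
  ρO⊆M {x} x∈O = Q⊆M (ρ x) (ρ-InQ widths x (O⊆Q x∈O))

  R⊆M : SubM ℓ R
  R⊆M y y∈R with f , f∈O , refl ← Equivalence.to (R-image y) y∈R = ρO⊆M f∈O

  wt∘ρ : ∀ {x} → x ∈ O → wt (ρ x) ≡ wt x
  wt∘ρ {x} x∈O = rank-constant (ρ x) x (ρO⊆M x∈O) (Q⊆M x (O⊆Q x∈O)) (rank-ρ x (O⊆Q x∈O))

  open Exchange ℓ wt A⊆M (λ x x∈O → proj₁ (O⊆A∩Q x x∈O)) R⊆M P⊆M P∩A≡∅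
    (λ x∈O y∈O → ρ-injectiveOnQ (O⊆Q x∈O) (O⊆Q y∈O)) R-image wt∘ρ σ wt≤wt∘σ
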